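{- Let $k \ge 2$ be an integer and let $D$ be a $k$-quasi-transitive digraph. Then $D$ has a $(k+1)$-king if and only if $D$ has a unique initial strong component.
   Context: All digraphs are finite, without loops and without multiple arcs in the same direction; paths are directed. For $u,v \in V(D)$, $d(u,v)$ is the length of a shortest directed $uv$-path ($d(u,v)=\infty$ if none exists, $d(v,v)=0$). For a positive integer $r$, a vertex $v$ is an $r$-king of $D$ if $d(v,u) \le r$ for every $u \in V(D)$. For an integer $k\ge 2$, $D$ is $k$-quasi-transitive if for every directed path $(v_0, v_1, \dots, v_k)$ of length $k$ in $D$, $(v_0,v_k) \in A(D)$ or $(v_k,v_0) \in A(D)$. A strong component is a maximal strongly connected subdigraph; an initial strong component is a strong component $S$ such that no arc of $D$ goes from a vertex outside $S$ to a vertex of $S$. -}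

module Defs where

open import Data.Nat using (ℕ; zero; suc; _≤_)
open import Data.Fin using (Fin; inject₁; fromℕ)
open import Data.Bool using (Bool; true; false)
open import Data.Vec using (Vec; lookup; head; last)
open import Data.Product using (Σ; ∃; _×_; ∃-syntax)
open import Data.Sum using (_⊎_)
open import Relation.Binary.PropositionalEquality using (_≡_; _≢_)

record Digraph : Set where
  field
    n        : ℕ
    arc      : Fin n → Fin n → Bool
    loopless : ∀ v → arc v v ≡ false

open Digraph public

VSet : Digraph → Set
VSet D = Fin (n D) → Bool

full : (D : Digraph) → VSet D
full D _ = true

IsPathIn : (D : Digraph) (S : VSet D) {m : ℕ} → Vec (Fin (n D)) (suc m) → Set
IsPathIn D S {m} vs =
  (∀ (i : Fin m) → arc D (lookup vs (inject₁ i)) (lookup vs (Fin.suc i)) ≡ true)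
  × (∀ i j → lookup vs i ≡ lookup vs j → i ≡ j)
  × (∀ i → S (lookup vs i) ≡ true)

PathIn : (D : Digraph) (S : VSet D) (u v : Fin (n D)) (m : ℕ) → Set
PathIn D S u v m =
  Σ (Vec (Fin (n D)) (suc m)) λ vs →
    IsPathIn D S vs × (head vs ≡ u) × (last vs ≡ v)

Path : (D : Digraph) (u v : Fin (n D)) (m : ℕ) → Set
Path D = PathIn D (full D)

dist≤ : (D : Digraph) (u v : Fin (n D)) (r : ℕ) → Set
dist≤ D u v r = ∃[ m ] (m ≤ r × Path D u v m)

IsKing : (D : Digraph) (r : ℕ) (v : Fin (n D)) → Set
IsKing D r v = ∀ u → dist≤ D v u r

HasKing : (D : Digraph) (r : ℕ) → Set
HasKing D r = ∃[ v ] IsKing D r v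

QuasiTransitive : (k : ℕ) (D : Digraph) → Set
QuasiTransitive k D =
  ∀ (vs : Vec (Fin (n D)) (suc k)) → IsPathIn D (full D) vs →
    (arc D (head vs) (last vs) ≡ true) ⊎ (arc D (last vs) (head vs) ≡ true)

_⊆_ : {D : Digraph} → VSet D → VSet D → Set
S ⊆ T = ∀ v → S v ≡ true → T v ≡ true

_≐_ : {D : Digraph} → VSet D → VSet D → Set
S ≐ T = ∀ v → S v ≡ T v

StronglyConnectedOn : (D : Digraph) → VSet D → Set
StronglyConnectedOn D S =
  (∃[ v ] S v ≡ true)
  × (∀ u v → S u ≡ true → S v ≡ true → ∃[ m ] PathIn D S u v m)

IsStrongComponent : (D : Digraph) → VSet D → Set
IsStrongComponent D S =
  StronglyConnectedOn D S
  × (∀ (T : VSet D) → _⊆_ {D} S T → StronglyConnectedOn D T → _≐_ {D} T S)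

IsInitialStrongComponent : (D : Digraph) → VSet D → Set
IsInitialStrongComponent D S =
  IsStrongComponent D S
  × (∀ u v → arc D u v ≡ true → S v ≡ true → S u ≡ true)

HasUniqueInitialStrongComponent : Digraph → Set
HasUniqueInitialStrongComponent D =
  ∃[ S ] (IsInitialStrongComponent D S
          × (∀ T → IsInitialStrongComponent D T → _≐_ {D} T S))

-- Both directions go through roots, i.e. vertices from which every vertex is
-- reachable.  A digraph has a unique initial strong component iff it has a
-- root: every vertex lies below some initial component, so a unique one
-- reaches everything.  Conversely, let v be a root of a k-quasi-transitive
-- digraph that is not a (k+1)-king, and let y be the vertex at distance k+2
-- on a shortest path v = f₀ … to a vertex beyond distance k+1.  By
-- quasi-transitivity f_i and f_(k+i) are adjacent, and a forward arc would be
-- a shortcut; so f_k → f₀ and f_(k+2) → f₂, hence y, f₂, …, f_k, f₀ is a path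
-- of length k and quasi-transitivity yields the arc y → v.  Then y is again a
-- root, and its (k+1)-ball strictly contains that of v: a vertex at distance
-- k+1 from v is at distance 3 from y, again by quasi-transitivity.  As the
-- balls cannot grow forever, some root is a (k+1)-king.
module Submission where

open import Defs
open import Data.Bool as Bool using (Bool; true; false)
open import Data.Empty using (⊥-elim)
open import Data.Fin as Fin using (Fin; toℕ; inject₁)
open import Data.Fin.Properties using (any?; all?; ¬∀⟶∃¬; toℕ-injective; toℕ<n; toℕ-inject₁; injective⇒≤)
open import Data.Fin.Subset using (Subset; _∈_; _⊂_; _⊃_)
open import Data.Fin.Subset.Induction using (⊂-wellFounded; ⊃-wellFounded)
open import Data.Nat using (ℕ; zero; suc; _+_; _∸_; _≤_; _<_; _≤?_; z≤n; s≤s)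
open import Data.Nat.Properties
open import Data.Product using (∃; ∃-syntax; _×_; _,_; proj₁; proj₂)
open import Data.Sum using (_⊎_; inj₁; inj₂; [_,_]′; fromInj₂)
open import Data.Vec using (Vec; lookup; head; last; tabulate; _∷_; [])
open import Data.Vec.Properties using (lookup∘tabulate; lookup⇒[]=; []=⇒lookup)
open import Function using (_∘_)
open import Induction.WellFounded using (Acc; acc)
open import Relation.Binary.Definitions using (tri<; tri≈; tri>)
open import Relation.Binary.PropositionalEquality
open import Relation.Nullary using (Dec; yes; no; does; ¬_; contradiction)
open import Relation.Nullary.Decidable using (_×-dec_; ¬?; dec-true; decidable-stable)
open import Relation.Unary using (Decidable)

does-true : ∀ {A : Set} (a? : Dec A) → does a? ≡ true → A
does-true (yes a) _ = a

true-⇔⇒≡ : ∀ {a b : Bool} → (a ≡ true → b ≡ true) → (b ≡ true → a ≡ true) → a ≡ b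
true-⇔⇒≡ {false} {false} _   _   = refl
true-⇔⇒≡ {false} {true}  _   b⇒a = b⇒a refl
true-⇔⇒≡ {true}  {false} a⇒b _   = sym (a⇒b refl)
true-⇔⇒≡ {true}  {true}  _   _   = refl

Minimal : (ℕ → Set) → ℕ → Set
Minimal P j = P j × (∀ {i} → i < j → ¬ P i)

minimal-unique : ∀ {P i j} → Minimal P i → Minimal P j → i ≡ j
minimal-unique {i = i} {j} (pi , i-min) (pj , j-min) with <-cmp i j
... | tri< i<j _ _ = contradiction pi (j-min i<j)
... | tri≈ _ i≡j _ = i≡j
... | tri> _ _ j<i = contradiction pj (i-min j<i)

minimal-below : ∀ {P} → Decidable P → ∀ b →
  (∀ {i} → i < b → ¬ P i) ⊎ ∃[ j ] (j < b × Minimal P j)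
minimal-below P? zero = inj₁ λ ()
minimal-below {P} P? (suc b) with minimal-below P? b
... | inj₂ (j , j<b , j-min) = inj₂ (j , m<n⇒m<1+n j<b , j-min)
... | inj₁ none with P? b
...   | yes pb = inj₂ (b , n<1+n b , pb , none)
...   | no ¬pb = inj₁ λ i<1+b → below-or-at (m<1+n⇒m<n∨m≡n i<1+b)
  where
  below-or-at : ∀ {i} → i < b ⊎ i ≡ b → ¬ P i
  below-or-at (inj₁ i<b) = none i<b
  below-or-at (inj₂ refl) = ¬pb

minimal : ∀ {P} → Decidable P → ∀ {m} → P m → ∃[ j ] (j ≤ m × Minimal P j)
minimal P? {m} pm with minimal-below P? (suc m)
... | inj₁ none = contradiction pm (none (n<1+n m))
... | inj₂ (j , j<1+m , j-min) = j , m<1+n⇒m≤n j<1+m , j-min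

∃<? : ∀ {P} → Decidable P → ∀ b → Dec (∃[ j ] (j < b × P j))
∃<? P? b with minimal-below P? b
... | inj₁ none = no λ { (j , j<b , pj) → none j<b pj }
... | inj₂ (j , j<b , pj , _) = yes (j , j<b , pj)

subset : ∀ {n} {P : Fin n → Set} → Decidable P → Subset n
subset P? = tabulate (does ∘ P?)

module _ {n} {P : Fin n → Set} (P? : Decidable P) where

  ∈-subset⁺ : ∀ {x} → P x → x ∈ subset P?
  ∈-subset⁺ {x} px =
    lookup⇒[]= x (subset P?) (trans (lookup∘tabulate (does ∘ P?) x) (dec-true (P? x) px))

  ∈-subset⁻ : ∀ {x} → x ∈ subset P? → P x
  ∈-subset⁻ {x} x∈ =
    does-true (P? x) (trans (sym (lookup∘tabulate (does ∘ P?) x)) ([]=⇒lookup x∈))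

subset-⊂ : ∀ {n} {P Q : Fin n → Set} (P? : Decidable P) (Q? : Decidable Q) →
  (∀ {x} → P x → Q x) → ∀ {x} → Q x → ¬ P x → subset P? ⊂ subset Q?
subset-⊂ P? Q? P⇒Q {x} qx ¬px =
  (λ x∈P → ∈-subset⁺ Q? (P⇒Q (∈-subset⁻ P? x∈P))) , x , ∈-subset⁺ Q? qx , ¬px ∘ ∈-subset⁻ P?

InjectiveOn : ∀ {A : Set} → (ℕ → A) → ℕ → Set
InjectiveOn h m = ∀ {a b} → a ≤ m → b ≤ m → h a ≡ h b → a ≡ b

extend : ∀ {A : Set} → (ℕ → A) → ℕ → A → ℕ → A
extend f j x i with i ≤? j
... | yes _ = f i
... | no _ = x

extend-≤ : ∀ {A : Set} (f : ℕ → A) {j} (x : A) {i} → i ≤ j → extend f j x i ≡ f i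
extend-≤ f {j} x {i} i≤j with i ≤? j
... | yes _ = refl
... | no i≰j = contradiction i≤j i≰j

extend-> : ∀ {A : Set} (f : ℕ → A) {j} (x : A) {i} → j < i → extend f j x i ≡ x
extend-> f {j} x {i} j<i with i ≤? j
... | yes i≤j = contradiction i≤j (<⇒≱ j<i)
... | no _ = refl

prefix : ∀ {A : Set} → (ℕ → A) → (m : ℕ) → Vec A (suc m)
prefix h m = tabulate (h ∘ toℕ)

lookup-prefix : ∀ {A : Set} (h : ℕ → A) m i → lookup (prefix h m) i ≡ h (toℕ i)
lookup-prefix h m = lookup∘tabulate (h ∘ toℕ)

last-prefix : ∀ {A : Set} (h : ℕ → A) m → last (prefix h m) ≡ h m
last-prefix h zero = refl
last-prefix h (suc m) = last-prefix (h ∘ suc) m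

module _ (D : Digraph) where

  V : Set
  V = Fin (n D)

  Arc : V → V → Set
  Arc u v = arc D u v ≡ true

  Walk : V → V → ℕ → Set
  Walk u v zero = u ≡ v
  Walk u v (suc m) = ∃[ p ] (Walk u p m × Arc p v)

  walk? : ∀ u v m → Dec (Walk u v m)
  walk? u v zero = u Fin.≟ v
  walk? u v (suc m) = any? λ p → walk? u p m ×-dec (arc D p v Bool.≟ true)

  arc◅walk : ∀ {a b c m} → Arc a b → Walk b c m → Walk a c (suc m)
  arc◅walk {m = zero} e refl = _ , refl , e
  arc◅walk {m = suc m} e (p , w , e′) = p , arc◅walk e w , e′

  walk-++ : ∀ {a b c m l} → Walk a b m → Walk b c l → Walk a c (l + m)
  walk-++ {l = zero} w refl = w
  walk-++ {l = suc l} w (p , w′ , e) = p , walk-++ w w′ , e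

  Reach : V → V → Set
  Reach u v = ∃ (Walk u v)

  reach-refl : ∀ {u} → Reach u u
  reach-refl = 0 , refl

  reach-trans : ∀ {a b c} → Reach a b → Reach b c → Reach a c
  reach-trans (_ , w) (_ , w′) = _ , walk-++ w w′

  arc◅reach : ∀ {a b c} → Arc a b → Reach b c → Reach a c
  arc◅reach e (_ , w) = _ , arc◅walk e w

  Dist : V → V → ℕ → Set
  Dist u v = Minimal (Walk u v)

  dist-refl : ∀ {u} → Dist u u 0
  dist-refl = refl , λ ()

  dist-arc-≤ : ∀ {u a b i j} → Dist u a i → Dist u b j → Arc a b → j ≤ suc i
  dist-arc-≤ (wa , _) (_ , b-min) e = ≮⇒≥ λ 1+i<j → b-min 1+i<j (_ , wa , e)

  dist-pred : ∀ {u x j} → Dist u x (suc j) → ∃[ p ] (Dist u p j × Arc p x)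
  dist-pred ((p , w , e) , x-min) = p , (w , λ i<j wi → x-min (s≤s i<j) (p , wi , e)) , e

  injectiveOn-byDist : ∀ {u m} {h : ℕ → V} {δ : ℕ → ℕ} →
    (∀ {a} → a ≤ m → Dist u (h a) (δ a)) → InjectiveOn δ m → InjectiveOn h m
  injectiveOn-byDist {u} dist δ-inj a≤m b≤m ha≡hb =
    δ-inj a≤m b≤m (minimal-unique (dist a≤m) (subst (λ w → Dist u w _) (sym ha≡hb) (dist b≤m)))

  record Geodesic (u x : V) (j : ℕ) : Set where
    field
      vertex : ℕ → V
      dist-vertex : ∀ {i} → i ≤ j → Dist u (vertex i) i
      arc-vertex : ∀ {i} → i < j → Arc (vertex i) (vertex (suc i))
      vertex-last : vertex j ≡ x

    vertex-first : vertex 0 ≡ u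
    vertex-first = sym (proj₁ (dist-vertex z≤n))

    vertex-injective : InjectiveOn vertex j
    vertex-injective = injectiveOn-byDist dist-vertex (λ _ _ e → e)

    vertex-walk : ∀ d {i} → d + i ≤ j → Walk (vertex i) (vertex (d + i)) d
    vertex-walk zero _ = refl
    vertex-walk (suc d) {i} d+i<j = vertex (d + i) , vertex-walk d (<⇒≤ d+i<j) , arc-vertex d+i<j

    vertex-reaches-last : ∀ {i} → i ≤ j → Reach (vertex i) x
    vertex-reaches-last {i} i≤j =
      j ∸ i , subst (λ w → Walk (vertex i) w (j ∸ i)) (trans (cong vertex (m∸n+n≡m i≤j)) vertex-last)
                (vertex-walk (j ∸ i) (≤-reflexive (m∸n+n≡m i≤j)))

  geodesic : ∀ {u x} j → Dist u x j → Geodesic u x j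
  geodesic {u} zero (refl , _) = record
    { vertex = λ _ → u ; dist-vertex = λ { z≤n → refl , λ () } ; arc-vertex = λ () ; vertex-last = refl }
  geodesic {u} {x} (suc j) d with dist-pred d
  ... | p , p-dist , p→x = record
    { vertex = vertex′ ; dist-vertex = dist′ ; arc-vertex = arc′ ; vertex-last = extend-> vertex x (n<1+n j) }
    where
    open Geodesic (geodesic j p-dist)
    vertex′ : ℕ → V
    vertex′ = extend vertex j x
    dist′ : ∀ {i} → i ≤ suc j → Dist u (vertex′ i) i
    dist′ {i} i≤1+j with i ≤? j
    ... | yes i≤j = dist-vertex i≤j
    ... | no i≰j rewrite ≤-antisym i≤1+j (≰⇒> i≰j) = d
    arc′ : ∀ {i} → i < suc j → Arc (vertex′ i) (vertex′ (suc i))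
    arc′ i<1+j with m<1+n⇒m<n∨m≡n i<1+j
    ... | inj₁ i<j rewrite extend-≤ vertex x (<⇒≤ i<j) | extend-≤ vertex x i<j = arc-vertex i<j
    ... | inj₂ refl rewrite extend-≤ vertex x (≤-refl {j}) | extend-> vertex x (n<1+n j) | vertex-last = p→x

  prefix-isPathIn : ∀ (S : VSet D) (h : ℕ → V) m → (∀ {i} → i < m → Arc (h i) (h (suc i))) →
    InjectiveOn h m → (∀ {a} → a ≤ m → S (h a) ≡ true) → IsPathIn D S (prefix h m)
  prefix-isPathIn S h m arcs inj inS = arcs′ , distinct , inS′
    where
    bound : ∀ (i : Fin (suc m)) → toℕ i ≤ m
    bound i = m<1+n⇒m≤n (toℕ<n i)
    arcs′ : ∀ (i : Fin m) → Arc (lookup (prefix h m) (inject₁ i)) (lookup (prefix h m) (Fin.suc i))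
    arcs′ i rewrite lookup-prefix h m (inject₁ i) | lookup-prefix h m (Fin.suc i) | toℕ-inject₁ i =
      arcs (toℕ<n i)
    distinct : ∀ i j → lookup (prefix h m) i ≡ lookup (prefix h m) j → i ≡ j
    distinct i j e =
      toℕ-injective (inj (bound i) (bound j) (trans (sym (lookup-prefix h m i)) (trans e (lookup-prefix h m j))))
    inS′ : ∀ i → S (lookup (prefix h m) i) ≡ true
    inS′ i rewrite lookup-prefix h m i = inS (bound i)

  geodesic⇒pathIn : ∀ {u x j} (g : Geodesic u x j) (S : VSet D) →
    (∀ {i} → i ≤ j → S (Geodesic.vertex g i) ≡ true) → PathIn D S u x j
  geodesic⇒pathIn {j = j} g S inS =
    prefix vertex j , prefix-isPathIn S vertex j arc-vertex vertex-injective inS ,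
    vertex-first , trans (last-prefix vertex j) vertex-last
    where open Geodesic g

  walk⇒dist≤ : ∀ {u v m} → Walk u v m → dist≤ D u v m
  walk⇒dist≤ {u} {v} w with minimal (walk? u v) w
  ... | j , j≤m , d = j , j≤m , geodesic⇒pathIn (geodesic j d) (full D) (λ _ → refl)

  vec⇒walk : ∀ {m} (vs : Vec V (suc m)) →
    (∀ (i : Fin m) → Arc (lookup vs (inject₁ i)) (lookup vs (Fin.suc i))) → Walk (head vs) (last vs) m
  vec⇒walk {zero} (x ∷ []) _ = refl
  vec⇒walk {suc m} (x ∷ y ∷ ys) arcs = arc◅walk (arcs Fin.zero) (vec⇒walk (y ∷ ys) (arcs ∘ Fin.suc))

  pathIn⇒reach : ∀ S {u v m} → PathIn D S u v m → Reach u v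
  pathIn⇒reach S (vs , (arcs , _) , refl , refl) = _ , vec⇒walk vs arcs

  dist-bound : ∀ {u x j} → Dist u x j → j < n D
  dist-bound {j = j} d =
    injective⇒≤ {f = vertex ∘ toℕ} λ e → toℕ-injective (vertex-injective (bound _) (bound _) e)
    where
    open Geodesic (geodesic j d)
    bound : ∀ (i : Fin (suc j)) → toℕ i ≤ j
    bound i = m<1+n⇒m≤n (toℕ<n i)

  reach? : ∀ u v → Dec (Reach u v)
  reach? u v with ∃<? (walk? u v) (n D)
  ... | yes (j , _ , w) = yes (j , w)
  ... | no none = no λ { (_ , w) → let (j , _ , d) = minimal (walk? u v) w in none (j , dist-bound d , proj₁ d) }

  component : V → VSet D
  component y x = does (reach? x y ×-dec reach? y x)

  ∈-component⁺ : ∀ {y x} → Reach x y → Reach y x → component y x ≡ true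
  ∈-component⁺ {y} {x} x↠y y↠x = dec-true (reach? x y ×-dec reach? y x) (x↠y , y↠x)

  ∈-component⁻ : ∀ {y x} → component y x ≡ true → Reach x y × Reach y x
  ∈-component⁻ {y} {x} = does-true (reach? x y ×-dec reach? y x)

  component-stronglyConnected : ∀ y → StronglyConnectedOn D (component y)
  component-stronglyConnected y = (y , ∈-component⁺ reach-refl reach-refl) , path
    where
    path : ∀ a b → component y a ≡ true → component y b ≡ true → ∃[ m ] PathIn D (component y) a b m
    path a b a∈ b∈ with ∈-component⁻ a∈ | ∈-component⁻ b∈
    ... | a↠y , y↠a | b↠y , y↠b with minimal (walk? a b) (proj₂ (reach-trans a↠y y↠b))
    ...   | j , _ , d = j , geodesic⇒pathIn g (component y) on-path
      where
      g : Geodesic a b j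
      g = geodesic j d
      open Geodesic g
      on-path : ∀ {i} → i ≤ j → component y (vertex i) ≡ true
      on-path {i} i≤j = ∈-component⁺ (reach-trans (vertex-reaches-last i≤j) b↠y)
                                     (reach-trans y↠a (i , proj₁ (dist-vertex i≤j)))

  component-isStrongComponent : ∀ y → IsStrongComponent D (component y)
  component-isStrongComponent y = component-stronglyConnected y , maximal
    where
    maximal : ∀ T → _⊆_ {D} (component y) T → StronglyConnectedOn D T → _≐_ {D} T (component y)
    maximal T y⊆T (_ , pathT) v = true-⇔⇒≡ v∈T⇒v∈y (y⊆T v)
      where
      y∈T : T y ≡ true
      y∈T = y⊆T y (∈-component⁺ reach-refl reach-refl)
      v∈T⇒v∈y : T v ≡ true → component y v ≡ true
      v∈T⇒v∈y v∈T = ∈-component⁺ (pathIn⇒reach T (proj₂ (pathT v y v∈T y∈T)))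
                                 (pathIn⇒reach T (proj₂ (pathT y v y∈T v∈T)))

  walk-backClosed : (T : VSet D) → (∀ u v → Arc u v → T v ≡ true → T u ≡ true) →
    ∀ {a b m} → Walk a b m → T b ≡ true → T a ≡ true
  walk-backClosed T closed {m = zero} refl b∈T = b∈T
  walk-backClosed T closed {m = suc m} (p , w , e) b∈T = walk-backClosed T closed w (closed p _ e b∈T)

  king⇒root : ∀ {r c} → IsKing D r c → ∀ x → Reach c x
  king⇒root c-king x = pathIn⇒reach (full D) (proj₂ (proj₂ (c-king x)))

  root⇒uniqueInitial : ∀ c → (∀ x → Reach c x) → HasUniqueInitialStrongComponent D
  root⇒uniqueInitial c c↠ = component c , (component-isStrongComponent c , initial) , unique
    where
    initial : ∀ u v → Arc u v → component c v ≡ true → component c u ≡ true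
    initial u v e v∈c = ∈-component⁺ (arc◅reach e (proj₁ (∈-component⁻ v∈c))) (c↠ u)
    unique : ∀ T → IsInitialStrongComponent D T → _≐_ {D} T (component c)
    unique T ((((t , t∈T) , pathT) , maximalT) , closedT) v =
      sym (maximalT (component c) T⊆c (component-stronglyConnected c) v)
      where
      c∈T : T c ≡ true
      c∈T = walk-backClosed T closedT (proj₂ (c↠ t)) t∈T
      T⊆c : _⊆_ {D} T (component c)
      T⊆c x x∈T = ∈-component⁺ (pathIn⇒reach T (proj₂ (pathT x c x∈T c∈T))) (c↠ x)

  ancestors : V → Subset (n D)
  ancestors y = subset (λ x → reach? x y)

  EntryArc : V → V → V → Set
  EntryArc y u z = Arc u z × component y z ≡ true × component y u ≢ true

  entryArc? : ∀ y u z → Dec (EntryArc y u z)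
  entryArc? y u z =
    (arc D u z Bool.≟ true) ×-dec (component y z Bool.≟ true) ×-dec ¬? (component y u Bool.≟ true)

  initialComponent-reaching : ∀ y → Acc _⊂_ (ancestors y) →
    ∃[ c ] (IsInitialStrongComponent D (component c) × Reach c y)
  initialComponent-reaching y (acc smaller) with any? (λ u → any? (entryArc? y u))
  ... | no noEntry = y , (component-isStrongComponent y , closed) , reach-refl
    where
    closed : ∀ u z → Arc u z → component y z ≡ true → component y u ≡ true
    closed u z e z∈y = decidable-stable (component y u Bool.≟ true) λ u∉y → noEntry (u , z , e , z∈y , u∉y)
  ... | yes (u , z , e , z∈y , u∉y) =
    let (c , initial , c↠u) = initialComponent-reaching u (smaller fewer-ancestors)
    in c , initial , reach-trans c↠u u↠y
    where
    u↠y : Reach u y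
    u↠y = arc◅reach e (proj₁ (∈-component⁻ z∈y))
    fewer-ancestors : ancestors u ⊂ ancestors y
    fewer-ancestors = subset-⊂ (λ x → reach? x u) (λ x → reach? x y) (λ x↠u → reach-trans x↠u u↠y)
                        reach-refl (λ y↠u → u∉y (∈-component⁺ u↠y y↠u))

  uniqueInitial⇒root : HasUniqueInitialStrongComponent D → ∃[ s ] (∀ x → Reach s x)
  uniqueInitial⇒root (S , ((((s , s∈S) , _) , _) , _) , unique) = s , s↠
    where
    s↠ : ∀ x → Reach s x
    s↠ x with initialComponent-reaching x (⊂-wellFounded (ancestors x))
    ... | c , initial , c↠x = reach-trans (proj₁ (∈-component⁻ (trans (unique (component c) initial s) s∈S))) c↠x

  module King (k₀ : ℕ) (qt : QuasiTransitive (2 + k₀) D) where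

    k : ℕ
    k = 2 + k₀

    2+k≰k : ¬ 2 + k ≤ k
    2+k≰k = 1+n≰n ∘ ≤-trans (n≤1+n (suc k))

    qt-byDist : ∀ {u} (h : ℕ → V) (δ : ℕ → ℕ) → (∀ {a} → a ≤ k → Dist u (h a) (δ a)) → InjectiveOn δ k →
      (∀ {i} → i < k → Arc (h i) (h (suc i))) → Arc (h 0) (h k) ⊎ Arc (h k) (h 0)
    qt-byDist h δ dist δ-inj arcs =
      subst (λ w → Arc (h 0) w ⊎ Arc w (h 0)) (last-prefix h k)
        (qt (prefix h k) (prefix-isPathIn (full D) h k arcs (injectiveOn-byDist dist δ-inj) (λ _ → refl)))

    Near : V → V → Set
    Near v x = ∃[ j ] (j < 2 + k × Walk v x j)

    near? : ∀ v x → Dec (Near v x)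
    near? v x = ∃<? (walk? v x) (2 + k)

    near⇒dist≤ : ∀ {v x} → Near v x → dist≤ D v x (suc k)
    near⇒dist≤ (j , j<2+k , w) with walk⇒dist≤ w
    ... | m , m≤j , path = m , ≤-trans m≤j (≤-pred j<2+k) , path

    ball : V → Subset (n D)
    ball v = subset (near? v)

    module FarVertex {v y} (v→y : Dist v y (2 + k)) where
      open Geodesic (geodesic (2 + k) v→y) renaming (vertex to f)

      back-arc : ∀ {i} → i ≤ 2 → Arc (f (k + i)) (f i)
      back-arc {i} i≤2 = fromInj₂ (⊥-elim ∘ shortcut)
        (qt-byDist (λ a → f (a + i)) (_+ i) (dist-vertex ∘ shifted) (λ _ _ → +-cancelʳ-≡ i _ _)
                   (arc-vertex ∘ shifted))
        where
        shifted : ∀ {a} → a ≤ k → a + i ≤ 2 + k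
        shifted {a} a≤k = subst (a + i ≤_) (+-comm k 2) (+-mono-≤ a≤k i≤2)
        shortcut : ¬ Arc (f i) (f (k + i))
        shortcut forward =
          contradiction (+-cancelʳ-≤ i k 1 (dist-arc-≤ (dist-vertex (shifted z≤n)) (dist-vertex (shifted ≤-refl)) forward))
                        λ { (s≤s ()) }

      -- indices along f of the path y = f (2 + k), f 2, f 3, …, f k, f 0
      cycleIndex : ℕ → ℕ
      cycleIndex zero = 2 + k
      cycleIndex (suc m) = extend (2 +_) k₀ 0 m

      cycleIndex-suc-≤ : ∀ m → cycleIndex (suc m) ≤ k
      cycleIndex-suc-≤ m with m ≤? k₀
      ... | yes m≤k₀ = s≤s (s≤s m≤k₀)
      ... | no _ = z≤n

      cycleIndex-≤ : ∀ a → cycleIndex a ≤ 2 + k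
      cycleIndex-≤ zero = ≤-refl
      cycleIndex-≤ (suc m) = ≤-trans (cycleIndex-suc-≤ m) (m≤n+m k 2)

      cycleIndex-last : cycleIndex k ≡ 0
      cycleIndex-last = extend-> (2 +_) 0 (n<1+n k₀)

      cycleIndex-injective : InjectiveOn cycleIndex k
      cycleIndex-injective {zero} {zero} _ _ _ = refl
      cycleIndex-injective {zero} {suc b} _ _ e = contradiction (subst (_≤ k) (sym e) (cycleIndex-suc-≤ b)) 2+k≰k
      cycleIndex-injective {suc a} {zero} _ _ e = contradiction (subst (_≤ k) e (cycleIndex-suc-≤ a)) 2+k≰k
      cycleIndex-injective {suc a} {suc b} 1+a≤k 1+b≤k e = cong suc (inner (≤-pred 1+a≤k) (≤-pred 1+b≤k) e)
        where
        inner : ∀ {a b} → a ≤ suc k₀ → b ≤ suc k₀ → extend (2 +_) k₀ 0 a ≡ extend (2 +_) k₀ 0 b → a ≡ b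
        inner {a} {b} a≤ b≤ e with a ≤? k₀ | b ≤? k₀
        ... | yes _ | yes _ = +-cancelˡ-≡ 2 _ _ e
        ... | yes _ | no _ = contradiction e λ ()
        ... | no _ | yes _ = contradiction e λ ()
        ... | no a≰k₀ | no b≰k₀ = trans (≤-antisym a≤ (≰⇒> a≰k₀)) (sym (≤-antisym b≤ (≰⇒> b≰k₀)))

      cycle-arc : ∀ {i} → i < k → Arc (f (cycleIndex i)) (f (cycleIndex (suc i)))
      cycle-arc {zero} _ rewrite extend-≤ (2 +_) {k₀} 0 (z≤n {k₀}) =
        subst (λ w → Arc (f w) (f 2)) (+-comm k 2) (back-arc ≤-refl)
      cycle-arc {suc m} 2+m≤k with m ≤? k₀ | suc m ≤? k₀
      ... | no m≰k₀ | _ = contradiction (≤-pred (≤-pred 2+m≤k)) m≰k₀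
      ... | yes _ | yes _ = arc-vertex (s≤s (s≤s (<⇒≤ 2+m≤k)))
      ... | yes m≤k₀ | no 1+m≰k₀ rewrite ≤-antisym m≤k₀ (≤-pred (≰⇒> 1+m≰k₀)) =
        subst (λ w → Arc (f w) (f 0)) (+-identityʳ k) (back-arc z≤n)

      y→v : Arc y v
      y→v = [ subst₂ Arc vertex-last f₀≡v , v→y-absurd ]′
              (qt-byDist (f ∘ cycleIndex) cycleIndex (λ {a} _ → dist-vertex (cycleIndex-≤ a))
                         cycleIndex-injective cycle-arc)
        where
        f₀≡v : f (cycleIndex k) ≡ v
        f₀≡v = trans (cong f cycleIndex-last) vertex-first
        v→y-absurd : Arc (f (cycleIndex k)) (f (2 + k)) → Arc y v
        v→y-absurd e = contradiction (dist-arc-≤ dist-refl v→y (subst₂ Arc f₀≡v vertex-last e)) λ { (s≤s ()) }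

      walk₃-from-y : ∀ {x} → Dist v x (suc k) → Walk y x 3
      walk₃-from-y {x} d = [ forward , backward ]′ (qt-byDist h δ dist-h δ-injective arcs)
        where
        open Geodesic (geodesic (suc k) d) renaming
          (vertex to g; dist-vertex to dist-g; arc-vertex to arc-g; vertex-first to g-first; vertex-last to g-last)
        h : ℕ → V
        h zero = y
        h (suc m) = g m
        δ : ℕ → ℕ
        δ zero = 2 + k
        δ (suc m) = m
        dist-h : ∀ {a} → a ≤ k → Dist v (h a) (δ a)
        dist-h {zero} _ = v→y
        dist-h {suc m} 1+m≤k = dist-g (≤-trans (n≤1+n m) (m≤n⇒m≤1+n 1+m≤k))
        δ-injective : InjectiveOn δ k
        δ-injective {zero} {zero} _ _ _ = refl
        δ-injective {zero} {suc b} _ 1+b≤k e = contradiction (subst (_< k) (sym e) 1+b≤k) (2+k≰k ∘ <⇒≤)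
        δ-injective {suc a} {zero} 1+a≤k _ e = contradiction (subst (_< k) e 1+a≤k) (2+k≰k ∘ <⇒≤)
        δ-injective {suc a} {suc b} _ _ e = cong suc e
        arcs : ∀ {i} → i < k → Arc (h i) (h (suc i))
        arcs {zero} _ = subst (Arc y) (sym g-first) y→v
        arcs {suc m} 2+m≤k = arc-g (<⇒≤ (m<n⇒m<1+n 2+m≤k))
        forward : Arc y (g (suc k₀)) → Walk y x 3
        forward e = g k , (g (suc k₀) , (y , refl , e) , arc-g (n≤1+n k)) , subst (Arc (g k)) g-last (arc-g ≤-refl)
        backward : Arc (g (suc k₀)) y → Walk y x 3
        backward e = contradiction (dist-arc-≤ (dist-g (m≤n+m (suc k₀) 2)) v→y e) 2+k≰k

      near-v⇒near-y : ∀ {x} → Near v x → Near y x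
      near-v⇒near-y {x} (_ , j′<2+k , w) with minimal (walk? v x) w
      ... | j , j≤j′ , d with j ≤? k
      ...   | yes j≤k = suc j , s≤s (s≤s j≤k) , arc◅walk y→v (proj₁ d)
      ...   | no j≰k = 3 , s≤s (s≤s (s≤s (s≤s z≤n))) , walk₃-from-y (subst (Dist v x) j≡1+k d)
        where
        j≡1+k : j ≡ suc k
        j≡1+k = ≤-antisym (≤-pred (≤-trans (s≤s j≤j′) j′<2+k)) (≰⇒> j≰k)

      ball-⊂ : ball v ⊂ ball y
      ball-⊂ = subset-⊂ (near? v) (near? y) near-v⇒near-y (0 , s≤s z≤n , refl)
                 λ { (_ , j<2+k , w) → proj₂ v→y j<2+k w }

    root⇒king : ∀ v → (∀ x → Reach v x) → Acc _⊃_ (ball v) → HasKing D (suc k)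
    root⇒king v v↠ (acc larger) with all? (near? v)
    ... | yes all-near = v , λ x → near⇒dist≤ (all-near x)
    ... | no ¬all-near with ¬∀⟶∃¬ (n D) (Near v) (near? v) ¬all-near
    ...   | x , x-far with minimal (walk? v x) (proj₂ (v↠ x))
    ...     | j , _ , d = root⇒king y (λ z → arc◅reach y→v (v↠ z)) (larger ball-⊂)
      where
      open Geodesic (geodesic j d)
      y : V
      y = vertex (2 + k)
      open FarVertex (dist-vertex (≮⇒≥ λ j<2+k → x-far (j , j<2+k , proj₁ d)))

mainTheorem1 : (k : ℕ) → 2 ≤ k → (D : Digraph) → QuasiTransitive k D →
    (HasKing D (suc k) → HasUniqueInitialStrongComponent D)
    × (HasUniqueInitialStrongComponent D → HasKing D (suc k))
mainTheorem1 (suc (suc k₀)) (s≤s (s≤s z≤n)) D qt = king⇒uniqueInitial , uniqueInitial⇒king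
  where
  king⇒uniqueInitial : HasKing D (3 + k₀) → HasUniqueInitialStrongComponent D
  king⇒uniqueInitial (c , c-king) = root⇒uniqueInitial D c (king⇒root D c-king)
  uniqueInitial⇒king : HasUniqueInitialStrongComponent D → HasKing D (3 + k₀)
  uniqueInitial⇒king unique with uniqueInitial⇒root D unique
  ... | s , s↠ = King.root⇒king D k₀ qt s s↠ (⊃-wellFounded _)
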